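{- Let $k\ge2$, let $m$ be a positive integer, and let $\vec b=(b_0,b_1,\dots)$ and $\vec c=(c_0,c_1,\dots)$ be infinite sequences of integers. Suppose there exists a positive integer $u$ such that $b_jb_{j'}\equiv 0\pmod m$ for every pair of distinct integers $j,j'\in\{u,u+1,\dots,u+2k-1\}$. Then the sequence $\{\widehat{C}^{\vec b,\vec c}_{k,n}\bmod m\}_{n\ge0}$ is eventually periodic.
   Context: A $k$-dimensional balanced ballot path of length $kn$ is a sequence $P=(\vec s_1,\dots,\vec s_{kn})$ of standard unit vectors of $\mathbb{R}^k$ in which each $\vec e_i$ occurs exactly $n$ times and every intermediate point $\vec v_i=\sum_{j=1}^i\vec s_j$ ($0\le i\le kn$), $\vec x=(x_1,\dots,x_k)$, satisfies $x_1\ge\cdots\ge x_k$. The semisymmetric height of $\vec x\in\mathbb{Z}^k_{\ge0}$ is $g_k(\vec x)=\sum_{i=1}^k(k+1-2i)x_i$. A step $\vec e_i$ is a semisymmetric up-step if $i\le\lfloor k/2\rfloor$; all other steps (down-steps $\vec e_j$ with $j\ge k-\lfloor k/2\rfloor+1$, and for odd $k$ the neutral step $\vec e_{\lfloor k/2\rfloor+1}$) are non-up-steps. The semisymmetric weight of $P$ is $sswt_{\vec b,\vec c}(P)=\prod b_{u_i}\cdot\prod c_{u'_j}$, where the first product runs over the up-steps of $P$ with $u_i$ the semisymmetric height of the starting point of the $i$-th up-step, and the second runs over the non-up-steps with $u'_j$ the semisymmetric height of the resulting point of the $j$-th non-up-step. The $k$-dimensional semisymmetric weighted Catalan number is $\widehat{C}^{\vec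 b,\vec c}_{k,n}=\sum_P sswt_{\vec b,\vec c}(P)$, summed over all $k$-dimensional balanced ballot paths $P$ of length $kn$. -}

module Defs where

open import Data.Bool using (Bool; true; false; _∧_; if_then_else_)
open import Data.Nat as ℕ using (ℕ; zero; suc; _≤ᵇ_; _<ᵇ_; _≡ᵇ_)
open import Data.Fin using (Fin; toℕ; _≟_)
open import Data.List using (List; []; _∷_; map; concatMap; allFin; foldr)
open import Data.Integer as ℤ using (ℤ; +_; ∣_∣)
open import Relation.Nullary.Decidable using (does)

allB : ∀ {A : Set} → (A → Bool) → List A → Bool
allB p [] = true
allB p (a ∷ as) = p a ∧ allB p as

filterB : ∀ {A : Set} → (A → Bool) → List A → List A
filterB p [] = []
filterB p (a ∷ as) = if p a then a ∷ filterB p as else filterB p as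

-- Points of Z^k_{≥0} as functions Fin k → ℕ (coordinate i is x_{i+1}).
Point : ℕ → Set
Point k = Fin k → ℕ

origin : ∀ {k} → Point k
origin _ = 0

step : ∀ {k} → Point k → Fin k → Point k
step x i j = if does (i ≟ j) then suc (x j) else x j

isBallotPoint : ∀ {k} → Point k → Bool
isBallotPoint {k} x =
  allB (λ i → allB (λ j → if toℕ i ≤ᵇ toℕ j then x j ≤ᵇ x i else true) (allFin k)) (allFin k)

ballotFrom : ∀ {k} → ℕ → Point k → List (Fin k) → Bool
ballotFrom {k} n x [] = isBallotPoint x ∧ allB (λ i → x i ≡ᵇ n) (allFin k)
ballotFrom n x (i ∷ s) = isBallotPoint x ∧ ballotFrom n (step x i) s

words : (k L : ℕ) → List (List (Fin k))
words k zero = [] ∷ []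
words k (suc L) = concatMap (λ w → map (_∷ w) (allFin k)) (words k L)

-- k-dimensional balanced ballot paths of length k n (steps recorded by the index of e_i)
ballotPaths : (k n : ℕ) → List (List (Fin k))
ballotPaths k n = filterB (λ w → ballotFrom n origin w) (words k (k ℕ.* n))

sumℤ : List ℤ → ℤ
sumℤ = foldr ℤ._+_ (+ 0)

-- semisymmetric height g_k(x) = Σ_{i=1}^k (k+1-2i) x_i  (0-based j: coefficient k-1-2j)
ssHeightℤ : ∀ {k} → Point k → ℤ
ssHeightℤ {k} x = sumℤ (map (λ j → ((+ k) ℤ.- (+ 1) ℤ.- (+ (2 ℕ.* toℕ j))) ℤ.* (+ (x j))) (allFin k))

-- the height is nonnegative on Z^k_{≥0} points with x_1≥…≥x_k, so we use its absolute value as an index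
ssHeight : ∀ {k} → Point k → ℕ
ssHeight x = ∣ ssHeightℤ x ∣

-- e_i (1-based i) is an up-step iff i ≤ ⌊k/2⌋, i.e. 0-based index < ⌊k/2⌋
isUp : ∀ {k} → Fin k → Bool
isUp {k} i = toℕ i <ᵇ (k ℕ./ 2)

sswtFrom : ∀ {k} → (ℕ → ℤ) → (ℕ → ℤ) → Point k → List (Fin k) → ℤ
sswtFrom b c x [] = + 1
sswtFrom b c x (i ∷ s) =
  (if isUp i then b (ssHeight x) else c (ssHeight (step x i))) ℤ.* sswtFrom b c (step x i) s

sswt : ∀ {k} → (ℕ → ℤ) → (ℕ → ℤ) → List (Fin k) → ℤ
sswt b c P = sswtFrom b c origin P

ssCatalan : (k : ℕ) → (ℕ → ℤ) → (ℕ → ℤ) → ℕ → ℤ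
ssCatalan k b c n = sumℤ (map (sswt b c) (ballotPaths k n))

module Submission where

-- Write the Catalan number as a weighted sum over lattice paths, computed by a transfer recursion in
-- the current point. The weights only see the semisymmetric height g, which grows by at most k - 1
-- per step and never grows on a non-up-step. Hence a path from height below T₁ = u + (k - 1) that
-- reaches T₂ = T₁ + (k - 1) takes an up-step from a height s ∈ [u, T₁) and a later one from a height
-- s′ ∈ [T₁, T₂); the factor b_s b_s′ vanishes modulo m, so modulo m all points of height ≥ T₂ may be
-- removed. The truncated path sums only depend on the start point up to translation along (1, …, 1),
-- and every remaining point is a translate of a point of the box [0, T₂]^k. So the vector of residues
-- of the L-step sums on that box determines the next one; by pigeonhole it is eventually periodic in L.

module SemisymmetricCatalan where

  open import Defs
  open import Data.Bool using (Bool; true; false; _∧_; if_then_else_; T)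
  open import Data.Bool.Properties using (⇔→≡)
  open import Data.Empty using (⊥-elim)
  open import Data.Fin as Fin using (Fin; zero; suc; toℕ; _≟_; fromℕ<; finToFun; funToFin)
  open import Data.Fin.Properties using (pigeonhole; toℕ-fromℕ<; finToFun-funToFin)
  open import Data.Integer as ℤ using (ℤ; +_; _+_; _*_; _-_; -_; _≤_; _<_; +≤+; +<+; _/ℕ_; _%ℕ_)
  import Data.Integer.Properties as ℤ
  open import Data.Integer.DivMod using (n%ℕd<d; a≡a%ℕn+[a/ℕn]*n)
  open import Data.Integer.Divisibility.Signed using (_∣_; divides; ∣m∣n⇒∣m+n; ∣m⇒∣-m; ∣n⇒∣m*n)
  open import Data.Integer.Tactic.RingSolver using (solve-∀)
  open import Data.List using (List; []; _∷_; map; concatMap; allFin; _++_)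
  open import Data.List.Properties using (map-∘; map-tabulate)
  open import Data.List.Membership.Propositional using (_∈_)
  open import Data.List.Membership.Propositional.Properties using (∈-allFin)
  open import Data.List.Relation.Unary.Any using (here; there)
  open import Data.Nat as ℕ using (ℕ; zero; suc; _≤ᵇ_; _≡ᵇ_; z≤n; s≤s; NonZero; _^_)
  import Data.Nat.Properties as ℕ
  open import Data.Nat.DivMod using (_/_; _%_; m≡m%n+[m/n]*n; m%n<n)
  import Data.Nat.Tactic.RingSolver as ℕ-Solver
  open import Data.Product using (Σ; _×_; _,_)
  open import Function using (_∘_; mk⇔)
  open import Level using (Level)
  open import Relation.Binary.Bundles using (Setoid)
  open import Relation.Binary.Core using (Rel)
  open import Relation.Binary.Definitions using (Reflexive; Transitive)
  open import Relation.Binary.PropositionalEquality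
  open import Relation.Nullary using (yes; no)
  open import Relation.Nullary.Decidable using (does; dec-true)
  import Relation.Binary.Reasoning.Setoid as SetoidReasoning

  infix 4 _≡_mod_

  record _≡_mod_ (a b m : ℤ) : Set where
    constructor congruent
    field ∣-difference : m ∣ a - b

  open _≡_mod_ public

  ≡-mod-reflexive : ∀ {m a b} → a ≡ b → a ≡ b mod m
  ≡-mod-reflexive {a = a} refl = congruent (divides (+ 0) (ℤ.+-inverseʳ a))

  ≡-mod-sym : ∀ {m a b} → a ≡ b mod m → b ≡ a mod m
  ≡-mod-sym {a = a} {b} (congruent d) = congruent (subst (_ ∣_) (lemma a b) (∣m⇒∣-m d))
    where lemma : ∀ a b → - (a - b) ≡ b - a
          lemma = solve-∀

  ≡-mod-trans : ∀ {m a b c} → a ≡ b mod m → b ≡ c mod m → a ≡ c mod m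
  ≡-mod-trans {a = a} {b} {c} (congruent d) (congruent e) =
    congruent (subst (_ ∣_) (lemma a b c) (∣m∣n⇒∣m+n d e))
    where lemma : ∀ a b c → (a - b) + (b - c) ≡ a - c
          lemma = solve-∀

  ≡-mod-setoid : ℤ → Setoid _ _
  ≡-mod-setoid m = record
    { Carrier       = ℤ
    ; _≈_           = λ a b → a ≡ b mod m
    ; isEquivalence = record { refl = ≡-mod-reflexive refl ; sym = ≡-mod-sym ; trans = ≡-mod-trans }
    }

  +-cong-mod : ∀ {m a b c d} → a ≡ b mod m → c ≡ d mod m → a + c ≡ b + d mod m
  +-cong-mod {a = a} {b} {c} {d} (congruent e) (congruent f) =
    congruent (subst (_ ∣_) (lemma a b c d) (∣m∣n⇒∣m+n e f))
    where lemma : ∀ a b c d → (a - b) + (c - d) ≡ (a + c) - (b + d)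
          lemma = solve-∀

  *-congˡ-mod : ∀ {m a b} c → a ≡ b mod m → c * a ≡ c * b mod m
  *-congˡ-mod {a = a} {b} c (congruent e) = congruent (subst (_ ∣_) (lemma c a b) (∣n⇒∣m*n c e))
    where lemma : ∀ c a b → c * (a - b) ≡ c * a - c * b
          lemma = solve-∀

  ∣⇒*-≡-mod : ∀ {m c} a b → m ∣ c → c * a ≡ c * b mod m
  ∣⇒*-≡-mod {c = c} a b d = congruent (subst (_ ∣_) (lemma c a b) (∣n⇒∣m*n (a - b) d))
    where lemma : ∀ c a b → (a - b) * c ≡ c * a - c * b
          lemma = solve-∀

  sumOver : ∀ {A : Set} → List A → (A → ℤ) → ℤ
  sumOver xs f = sumℤ (map f xs)

  sumFin : ∀ {k} → (Fin k → ℤ) → ℤ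
  sumFin = sumOver (allFin _)

  module _ {A : Set} where

    sumOver-cong : ∀ xs {f g : A → ℤ} → (∀ a → f a ≡ g a) → sumOver xs f ≡ sumOver xs g
    sumOver-cong []       e = refl
    sumOver-cong (a ∷ xs) e = cong₂ _+_ (e a) (sumOver-cong xs e)

    sumOver-cong-mod : ∀ {m} xs {f g : A → ℤ} → (∀ a → f a ≡ g a mod m) →
      sumOver xs f ≡ sumOver xs g mod m
    sumOver-cong-mod []       e = ≡-mod-reflexive refl
    sumOver-cong-mod (a ∷ xs) e = +-cong-mod (e a) (sumOver-cong-mod xs e)

    sumOver-zero : ∀ xs → sumOver {A} xs (λ _ → + 0) ≡ + 0
    sumOver-zero []       = refl
    sumOver-zero (_ ∷ xs) = trans (ℤ.+-identityˡ _) (sumOver-zero xs)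

    sumOver-++ : ∀ xs ys (f : A → ℤ) → sumOver (xs ++ ys) f ≡ sumOver xs f + sumOver ys f
    sumOver-++ []       ys f = sym (ℤ.+-identityˡ _)
    sumOver-++ (a ∷ xs) ys f =
      trans (cong (λ s → f a + s) (sumOver-++ xs ys f)) (sym (ℤ.+-assoc (f a) _ _))

    sumOver-+ : ∀ xs (f g : A → ℤ) → sumOver xs (λ a → f a + g a) ≡ sumOver xs f + sumOver xs g
    sumOver-+ []       f g = refl
    sumOver-+ (a ∷ xs) f g =
      trans (cong (λ s → f a + g a + s) (sumOver-+ xs f g)) (lemma (f a) (g a) _ _)
      where lemma : ∀ x y z w → x + y + (z + w) ≡ x + z + (y + w)
            lemma = solve-∀

    *-distribˡ-sumOver : ∀ c xs (f : A → ℤ) → c * sumOver xs f ≡ sumOver xs (λ a → c * f a)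
    *-distribˡ-sumOver c []       f = ℤ.*-zeroʳ c
    *-distribˡ-sumOver c (a ∷ xs) f =
      trans (ℤ.*-distribˡ-+ c (f a) _) (cong (λ s → c * f a + s) (*-distribˡ-sumOver c xs f))

    sumOver-if : ∀ β xs (f : A → ℤ) →
      sumOver xs (λ a → if β then f a else + 0) ≡ (if β then sumOver xs f else + 0)
    sumOver-if true  xs f = refl
    sumOver-if false xs f = sumOver-zero xs

    sumOver-if-* : ∀ β xs c (f : A → ℤ) →
      sumOver xs (λ a → if β then c * f a else + 0) ≡ (if β then c * sumOver xs f else + 0)
    sumOver-if-* true  xs c f = sym (*-distribˡ-sumOver c xs f)
    sumOver-if-* false xs c f = sumOver-zero xs

    sumOver-filterB : ∀ (p : A → Bool) (f : A → ℤ) xs →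
      sumOver (filterB p xs) f ≡ sumOver xs (λ a → if p a then f a else + 0)
    sumOver-filterB p f []       = refl
    sumOver-filterB p f (a ∷ xs) with p a
    ... | true  = cong (λ s → f a + s) (sumOver-filterB p f xs)
    ... | false = trans (sumOver-filterB p f xs) (sym (ℤ.+-identityˡ _))

  sumOver-concatMap : ∀ {A B : Set} xs (g : A → List B) (f : B → ℤ) →
    sumOver (concatMap g xs) f ≡ sumOver xs (λ a → sumOver (g a) f)
  sumOver-concatMap []       g f = refl
  sumOver-concatMap (a ∷ xs) g f = trans (sumOver-++ (g a) (concatMap g xs) f)
    (cong (λ s → sumOver (g a) f + s) (sumOver-concatMap xs g f))

  sumOver-swap : ∀ {A B : Set} xs ys (f : A → B → ℤ) →
    sumOver xs (λ a → sumOver ys (f a)) ≡ sumOver ys (λ b → sumOver xs (λ a → f a b))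
  sumOver-swap []       ys f = sym (sumOver-zero ys)
  sumOver-swap (a ∷ xs) ys f =
    trans (cong (λ s → sumOver ys (f a) + s) (sumOver-swap xs ys f)) (sym (sumOver-+ ys (f a) _))

  sumFin-suc : ∀ {k} (f : Fin (suc k) → ℤ) → sumFin f ≡ f zero + sumFin (f ∘ suc)
  sumFin-suc f = cong (λ xs → f zero + sumℤ xs)
    (trans (map-tabulate suc f) (sym (map-tabulate (λ i → i) (f ∘ suc))))

  sumFin-const : ∀ k c → sumFin {k} (λ _ → c) ≡ + k * c
  sumFin-const zero    c = sym (ℤ.*-zeroˡ c)
  sumFin-const (suc k) c =
    trans (sumFin-suc {k} (λ _ → c)) (trans (cong (λ s → c + s) (sumFin-const k c)) (lemma (+ k) c))
    where lemma : ∀ k c → c + k * c ≡ (+ 1 + k) * c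
          lemma = solve-∀

  sumOver-words-suc : ∀ k L (f : List (Fin k) → ℤ) →
    sumOver (words k (suc L)) f ≡ sumFin (λ i → sumOver (words k L) (λ w → f (i ∷ w)))
  sumOver-words-suc k L f = begin
    sumOver (words k (suc L)) f
      ≡⟨ sumOver-concatMap (words k L) _ f ⟩
    sumOver (words k L) (λ w → sumOver (map (_∷ w) (allFin k)) f)
      ≡⟨ sumOver-cong (words k L) (λ w → cong sumℤ (sym (map-∘ (allFin k)))) ⟩
    sumOver (words k L) (λ w → sumFin (λ i → f (i ∷ w)))
      ≡⟨ sumOver-swap (words k L) (allFin k) (λ w i → f (i ∷ w)) ⟩
    sumFin (λ i → sumOver (words k L) (λ w → f (i ∷ w)))
      ∎
    where open ≡-Reasoning

  i≤i+j : ∀ {i j} → + 0 ≤ j → i ≤ i + j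
  i≤i+j {i} {j} 0≤j = subst (_≤ i + j) (ℤ.+-identityʳ i) (ℤ.+-monoʳ-≤ i 0≤j)

  i≤j+i : ∀ {i j} → + 0 ≤ j → i ≤ j + i
  i≤j+i {i} {j} 0≤j = subst (i ≤_) (ℤ.+-comm i j) (i≤i+j 0≤j)

  module _ {A : Set} {f : A → ℤ} (f≥0 : ∀ a → + 0 ≤ f a) where

    sumOver-nonneg : ∀ xs → + 0 ≤ sumOver xs f
    sumOver-nonneg []       = ℤ.≤-refl
    sumOver-nonneg (a ∷ xs) = ℤ.+-mono-≤ (f≥0 a) (sumOver-nonneg xs)

    ≤-sumOver : ∀ {a xs} → a ∈ xs → f a ≤ sumOver xs f
    ≤-sumOver {xs = _ ∷ xs} (here refl)  = i≤i+j (sumOver-nonneg xs)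
    ≤-sumOver {xs = b ∷ _}  (there a∈xs) = ℤ.≤-trans (≤-sumOver a∈xs) (i≤j+i (f≥0 b))

  module _ {ℓ : Level} (R : Rel ℕ ℓ) (R-refl : Reflexive R) (R-trans : Transitive R)
           (R-suc : ∀ {i j} → R i j → R (suc i) (suc j)) where

    R-+ : ∀ t {i j} → R i j → R (t ℕ.+ i) (t ℕ.+ j)
    R-+ zero    r = r
    R-+ (suc t) r = R-suc (R-+ t r)

    -- Pigeonhole on the codes of 0, 1, …, n gives i₀ < j₀ with R i₀ j₀; shifting gives the period.
    eventually-periodic : ∀ {n} (code : ℕ → Fin n) → (∀ {i j} → code i ≡ code j → R i j) →
      Σ ℕ λ N → Σ ℕ λ p → 1 ℕ.≤ p × (∀ c {i} → N ℕ.≤ i → R i (i ℕ.+ c ℕ.* p))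
    eventually-periodic {n} code code-determines with pigeonhole (ℕ.n<1+n n) (code ∘ toℕ)
    ... | i₀ , j₀ , i₀<j₀ , same-code = toℕ i₀ , p , ℕ.m<n⇒0<n∸m i₀<j₀ , periodic
      where
      p : ℕ
      p = toℕ j₀ ℕ.∸ toℕ i₀

      once : ∀ {i} → toℕ i₀ ℕ.≤ i → R i (i ℕ.+ p)
      once {i} i₀≤i = subst₂ R shift≡i shift≡i+p (R-+ (i ℕ.∸ toℕ i₀) (code-determines same-code))
        where
        shift≡i : i ℕ.∸ toℕ i₀ ℕ.+ toℕ i₀ ≡ i
        shift≡i = ℕ.m∸n+n≡m i₀≤i
        shift≡i+p : i ℕ.∸ toℕ i₀ ℕ.+ toℕ j₀ ≡ i ℕ.+ p
        shift≡i+p = begin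
          i ℕ.∸ toℕ i₀ ℕ.+ toℕ j₀           ≡⟨ cong (i ℕ.∸ toℕ i₀ ℕ.+_) (ℕ.m+[n∸m]≡n (ℕ.<⇒≤ i₀<j₀)) ⟨
          i ℕ.∸ toℕ i₀ ℕ.+ (toℕ i₀ ℕ.+ p)   ≡⟨ ℕ.+-assoc (i ℕ.∸ toℕ i₀) (toℕ i₀) p ⟨
          i ℕ.∸ toℕ i₀ ℕ.+ toℕ i₀ ℕ.+ p     ≡⟨ cong (ℕ._+ p) shift≡i ⟩
          i ℕ.+ p                           ∎
          where open ≡-Reasoning

      periodic : ∀ c {i} → toℕ i₀ ℕ.≤ i → R i (i ℕ.+ c ℕ.* p)
      periodic zero    {i} _     = subst (R i) (sym (ℕ.+-identityʳ i)) R-refl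
      periodic (suc c) {i} i₀≤i = R-trans (once i₀≤i)
        (subst (R (i ℕ.+ p)) (ℕ.+-assoc i p (c ℕ.* p)) (periodic c (ℕ.≤-trans i₀≤i (ℕ.m≤m+n i p))))

  residue : ∀ M .{{_ : NonZero M}} → ℤ → Fin M
  residue M a = fromℕ< (n%ℕd<d a M)

  residue-≡⇒≡-mod : ∀ M .{{_ : NonZero M}} {a b} → residue M a ≡ residue M b → a ≡ b mod + M
  residue-≡⇒≡-mod M {a} {b} same = congruent (divides (a /ℕ M - b /ℕ M) (begin
    a - b
      ≡⟨ cong₂ _-_ (a≡a%ℕn+[a/ℕn]*n a M) (a≡a%ℕn+[a/ℕn]*n b M) ⟩
    + (a %ℕ M) + a /ℕ M * + M - (+ (b %ℕ M) + b /ℕ M * + M)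
      ≡⟨ cong (λ r → + (a %ℕ M) + a /ℕ M * + M - (+ r + b /ℕ M * + M)) same-remainder ⟨
    + (a %ℕ M) + a /ℕ M * + M - (+ (a %ℕ M) + b /ℕ M * + M)
      ≡⟨ lemma (+ (a %ℕ M)) (a /ℕ M) (b /ℕ M) (+ M) ⟩
    (a /ℕ M - b /ℕ M) * + M
      ∎))
    where
    open ≡-Reasoning
    same-remainder : a %ℕ M ≡ b %ℕ M
    same-remainder =
      trans (sym (toℕ-fromℕ< (n%ℕd<d a M))) (trans (cong toℕ same) (toℕ-fromℕ< (n%ℕd<d b M)))
    lemma : ∀ r q q′ M → r + q * M - (r + q′ * M) ≡ (q - q′) * M
    lemma = solve-∀

  allB-cong : ∀ {A : Set} xs {p q : A → Bool} → (∀ a → p a ≡ q a) → allB p xs ≡ allB q xs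
  allB-cong []       e = refl
  allB-cong (a ∷ xs) e = cong₂ _∧_ (e a) (allB-cong xs e)

  allB-sound : ∀ {A : Set} (p : A → Bool) {xs} → allB p xs ≡ true → ∀ {a} → a ∈ xs → p a ≡ true
  allB-sound p {a ∷ xs} h (here refl) with p a
  ... | true = refl
  allB-sound p {b ∷ xs} h (there a∈xs) with p b
  ... | true = allB-sound p h a∈xs

  ≤ᵇ-suc : ∀ a b → (suc a ≤ᵇ suc b) ≡ (a ≤ᵇ b)
  ≤ᵇ-suc zero    b = refl
  ≤ᵇ-suc (suc a) b = refl

  +-≤ᵇ : ∀ t {a b} → (t ℕ.+ a ≤ᵇ t ℕ.+ b) ≡ (a ≤ᵇ b)
  +-≤ᵇ zero            = refl
  +-≤ᵇ (suc t) {a} {b} = trans (≤ᵇ-suc (t ℕ.+ a) (t ℕ.+ b)) (+-≤ᵇ t)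

  +-≡ᵇ : ∀ t {a b} → (t ℕ.+ a ≡ᵇ t ℕ.+ b) ≡ (a ≡ᵇ b)
  +-≡ᵇ zero    = refl
  +-≡ᵇ (suc t) = +-≡ᵇ t

  ≤ᵇ-shift : ∀ a b c d → a ℕ.+ d ≡ c ℕ.+ b → (b ≤ᵇ a) ≡ (d ≤ᵇ c)
  ≤ᵇ-shift a b c d e = begin
    (b ≤ᵇ a)               ≡⟨ +-≤ᵇ d ⟨
    (d ℕ.+ b ≤ᵇ d ℕ.+ a)   ≡⟨ cong (d ℕ.+ b ≤ᵇ_) (trans (ℕ.+-comm d a) e) ⟩
    (d ℕ.+ b ≤ᵇ c ℕ.+ b)   ≡⟨ cong₂ _≤ᵇ_ (ℕ.+-comm d b) (ℕ.+-comm c b) ⟩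
    (b ℕ.+ d ≤ᵇ b ℕ.+ c)   ≡⟨ +-≤ᵇ b ⟩
    (d ≤ᵇ c)               ∎
    where open ≡-Reasoning

  ≡ᵇ-shift : ∀ a b c d → a ℕ.+ d ≡ c ℕ.+ b → (a ≡ᵇ b) ≡ (c ≡ᵇ d)
  ≡ᵇ-shift a b c d e = begin
    (a ≡ᵇ b)               ≡⟨ +-≡ᵇ d ⟨
    (d ℕ.+ a ≡ᵇ d ℕ.+ b)   ≡⟨ cong (ℕ._≡ᵇ d ℕ.+ b) (trans (ℕ.+-comm d a) e) ⟩
    (c ℕ.+ b ≡ᵇ d ℕ.+ b)   ≡⟨ cong₂ _≡ᵇ_ (ℕ.+-comm c b) (ℕ.+-comm d b) ⟩
    (b ℕ.+ c ≡ᵇ b ℕ.+ d)   ≡⟨ +-≡ᵇ b ⟩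
    (c ≡ᵇ d)               ∎
    where open ≡-Reasoning

  +-suc-cong : ∀ {p q r s} → p ℕ.+ q ≡ r ℕ.+ s → p ℕ.+ suc q ≡ r ℕ.+ suc s
  +-suc-cong {p} {q} {r} {s} e = trans (ℕ.+-suc p q) (trans (cong suc e) (sym (ℕ.+-suc r s)))

  -- x ∼ y: the points x and y differ by a constant vector.
  record _∼_ {k} (x y : Point k) : Set where
    constructor shifted
    field cross : ∀ i j → x i ℕ.+ y j ≡ y i ℕ.+ x j

  open _∼_ public

  step-∼ : ∀ {k} {x y : Point k} i → x ∼ y → step x i ∼ step y i
  step-∼ {x = x} {y} i (shifted x∼y) = shifted cross′
    where
    cross′ : ∀ a b → step x i a ℕ.+ step y i b ≡ step y i a ℕ.+ step x i b
    cross′ a b with does (i ≟ a) | does (i ≟ b)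
    ... | true  | true  = cong suc (+-suc-cong (x∼y a b))
    ... | true  | false = cong suc (x∼y a b)
    ... | false | true  = +-suc-cong (x∼y a b)
    ... | false | false = x∼y a b

  isBallotPoint-∼ : ∀ {k} {x y : Point k} → x ∼ y → isBallotPoint x ≡ isBallotPoint y
  isBallotPoint-∼ {k} {x} {y} x∼y = allB-cong (allFin k) λ i → allB-cong (allFin k) λ j →
    cong (λ b → if toℕ i ℕ.≤ᵇ toℕ j then b else true) (≤ᵇ-shift (x i) (x j) (y i) (y j) (cross x∼y i j))

  isDiagonalAt : ∀ {k} → ℕ → Point k → Bool
  isDiagonalAt {k} n x = allB (λ i → x i ℕ.≡ᵇ n) (allFin k)

  isDiagonal : ∀ {k} → Point (suc k) → Bool
  isDiagonal x = isDiagonalAt (x zero) x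

  isDiagonal-∼ : ∀ {k} {x y : Point (suc k)} → x ∼ y → isDiagonal x ≡ isDiagonal y
  isDiagonal-∼ {k} {x} {y} x∼y = allB-cong (allFin (suc k)) λ i →
    ≡ᵇ-shift (x i) (x zero) (y i) (y zero) (cross x∼y i zero)

  Ballot : ∀ {k} → Point k → Set
  Ballot x = ∀ {i j} → i Fin.≤ j → x j ℕ.≤ x i

  isBallotPoint⇒Ballot : ∀ {k} {x : Point k} → isBallotPoint x ≡ true → Ballot x
  isBallotPoint⇒Ballot {x = x} h {i} {j} i≤j
    with toℕ i ℕ.≤ᵇ toℕ j | ℕ.≤⇒≤ᵇ i≤j | allB-sound _ (allB-sound _ h (∈-allFin i)) (∈-allFin j)
  ... | true | _ | xj≤ᵇxi = ℕ.≤ᵇ⇒≤ (x j) (x i) (subst T (sym xj≤ᵇxi) _)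

  Ballot-tail : ∀ {k} {x : Point (suc k)} → Ballot x → Ballot (x ∘ suc)
  Ballot-tail ballot i≤j = ballot (s≤s i≤j)

  Ballot-gap : ∀ {k} {x : Point (suc k)} → Ballot x → ∀ j → + 0 ≤ + x zero - + x j
  Ballot-gap ballot j = ℤ.i≤j⇒0≤j-i (+≤+ (ballot z≤n))

  linear : ∀ {k} → (Fin k → ℤ) → Point k → ℤ
  linear a x = sumFin (λ j → a j * + x j)

  linear-origin : ∀ {k} (a : Fin k → ℤ) → linear a origin ≡ + 0
  linear-origin {k} a = trans (sumOver-cong (allFin k) λ j → ℤ.*-zeroʳ (a j)) (sumOver-zero (allFin k))

  linear-step : ∀ {k} (a : Fin k → ℤ) x i → linear a (step x i) ≡ a i + linear a x
  linear-step {suc k} a x zero = begin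
    linear a (step x zero)
      ≡⟨ sumFin-suc (λ j → a j * + step x zero j) ⟩
    a zero * (+ 1 + + x zero) + linear (a ∘ suc) (x ∘ suc)
      ≡⟨ lemma (a zero) (+ x zero) _ ⟩
    a zero + (a zero * + x zero + linear (a ∘ suc) (x ∘ suc))
      ≡⟨ cong (λ s → a zero + s) (sumFin-suc (λ j → a j * + x j)) ⟨
    a zero + linear a x
      ∎
    where open ≡-Reasoning
          lemma : ∀ a n s → a * (+ 1 + n) + s ≡ a + (a * n + s)
          lemma = solve-∀
  linear-step {suc k} a x (suc i) = begin
    linear a (step x (suc i))
      ≡⟨ sumFin-suc (λ j → a j * + step x (suc i) j) ⟩
    a zero * + x zero + linear (a ∘ suc) (step (x ∘ suc) i)
      ≡⟨ cong (λ s → a zero * + x zero + s) (linear-step (a ∘ suc) (x ∘ suc) i) ⟩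
    a zero * + x zero + (a (suc i) + linear (a ∘ suc) (x ∘ suc))
      ≡⟨ lemma (a zero * + x zero) (a (suc i)) _ ⟩
    a (suc i) + (a zero * + x zero + linear (a ∘ suc) (x ∘ suc))
      ≡⟨ cong (λ s → a (suc i) + s) (sumFin-suc (λ j → a j * + x j)) ⟨
    a (suc i) + linear a x
      ∎
    where open ≡-Reasoning
          lemma : ∀ p q s → p + (q + s) ≡ q + (p + s)
          lemma = solve-∀

  ssCoeff : (k : ℕ) → Fin k → ℤ
  ssCoeff k j = + k - + 1 - + (2 ℕ.* toℕ j)

  ssHeightℤ-step : ∀ {k} (x : Point k) i → ssHeightℤ (step x i) ≡ ssCoeff k i + ssHeightℤ x
  ssHeightℤ-step = linear-step (ssCoeff _)

  ssCoeff-zero : ∀ k → ssCoeff (suc k) zero ≡ + k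
  ssCoeff-zero k = lemma (+ k)
    where lemma : ∀ k → + 1 + k - + 1 - + 0 ≡ k
          lemma = solve-∀

  ssCoeff-suc : ∀ k (j : Fin k) → ssCoeff (suc k) (suc j) ≡ ssCoeff k j - + 1
  ssCoeff-suc k j = begin
    + 1 + + k - + 1 - + (2 ℕ.* suc t)    ≡⟨ cong (λ s → + 1 + + k - + 1 - s) (ℤ.pos-* 2 (suc t)) ⟩
    + 1 + + k - + 1 - + 2 * (+ 1 + + t)  ≡⟨ lemma (+ k) (+ t) ⟩
    + k - + 1 - + 2 * + t - + 1          ≡⟨ cong (λ s → + k - + 1 - s - + 1) (ℤ.pos-* 2 t) ⟨
    ssCoeff k j - + 1                    ∎
    where open ≡-Reasoning
          t : ℕ
          t = toℕ j
          lemma : ∀ k t → + 1 + k - + 1 - + 2 * (+ 1 + t) ≡ k - + 1 - + 2 * t - + 1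
          lemma = solve-∀

  ssCoeff-≤ : ∀ k (i : Fin (suc k)) → ssCoeff (suc k) i ≤ + k
  ssCoeff-≤ k i = subst (λ c → c - + (2 ℕ.* toℕ i) ≤ + k) (sym (lemma (+ k))) (ℤ.i-j≤i (+ k) (+ (2 ℕ.* toℕ i)))
    where lemma : ∀ k → + 1 + k - + 1 ≡ k
          lemma = solve-∀

  ssCoeff-nonUp : ∀ {k} (i : Fin k) → isUp i ≡ false → ssCoeff k i ≤ + 0
  ssCoeff-nonUp {k} i notUp = subst (_≤ + 0) (lemma (+ k) (+ (2 ℕ.* t))) (ℤ.i≤j⇒i-j≤0 (+≤+ k≤1+2t))
    where
    t : ℕ
    t = toℕ i
    k/2≤t : k / 2 ℕ.≤ t
    k/2≤t = ℕ.≮⇒≥ λ t<k/2 → subst T notUp (ℕ.<⇒<ᵇ t<k/2)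
    k≤1+2t : k ℕ.≤ suc (2 ℕ.* t)
    k≤1+2t = subst (ℕ._≤ suc (2 ℕ.* t)) (sym (m≡m%n+[m/n]*n k 2)) (ℕ.+-mono-≤ (ℕ.≤-pred (m%n<n k 2))
      (subst (k / 2 ℕ.* 2 ℕ.≤_) (ℕ.*-comm t 2) (ℕ.*-monoˡ-≤ 2 k/2≤t)))
    lemma : ∀ k t → k - (+ 1 + t) ≡ k - + 1 - t
    lemma = solve-∀

  ssHeightℤ-step-≤ : ∀ {k} (x : Point (suc k)) i → ssHeightℤ (step x i) ≤ + k + ssHeightℤ x
  ssHeightℤ-step-≤ {k} x i =
    subst (_≤ + k + ssHeightℤ x) (sym (ssHeightℤ-step x i)) (ℤ.+-monoˡ-≤ (ssHeightℤ x) (ssCoeff-≤ k i))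

  ssHeightℤ-step-nonUp : ∀ {k} (x : Point k) i → isUp i ≡ false → ssHeightℤ (step x i) ≤ ssHeightℤ x
  ssHeightℤ-step-nonUp x i notUp =
    subst₂ _≤_ (sym (ssHeightℤ-step x i)) (ℤ.+-identityˡ _) (ℤ.+-monoˡ-≤ (ssHeightℤ x) (ssCoeff-nonUp i notUp))

  -- Unfolded recursively, this is g(x) = Σ_{i < j} (x_i - x_j).
  ssHeightℤ-tail : ∀ {k} (x : Point (suc k)) →
    ssHeightℤ x ≡ ssHeightℤ (x ∘ suc) + sumFin (λ j → + x zero - + x (suc j))
  ssHeightℤ-tail {k} x = begin
    ssHeightℤ x
      ≡⟨ sumFin-suc (λ j → ssCoeff (suc k) j * + x j) ⟩
    ssCoeff (suc k) zero * x₀ + sumFin (λ j → ssCoeff (suc k) (suc j) * + x (suc j))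
      ≡⟨ cong₂ (λ a s → a * x₀ + s) (ssCoeff-zero k) (sumOver-cong (allFin k) λ j →
           trans (cong (_* + x (suc j)) (ssCoeff-suc k j)) (split (ssCoeff k j) (+ x (suc j)) x₀)) ⟩
    + k * x₀ + sumFin (λ j → ssCoeff k j * + x (suc j) + (x₀ - + x (suc j)) + - x₀)
      ≡⟨ cong (λ s → + k * x₀ + s) (trans (sumOver-+ (allFin k) _ (λ _ → - x₀))
           (cong₂ _+_ (sumOver-+ (allFin k) _ _) (sumFin-const k (- x₀)))) ⟩
    + k * x₀ + (ssHeightℤ (x ∘ suc) + sumFin (λ j → x₀ - + x (suc j)) + + k * - x₀)
      ≡⟨ cancel (+ k) x₀ (ssHeightℤ (x ∘ suc)) (sumFin (λ j → x₀ - + x (suc j))) ⟩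
    ssHeightℤ (x ∘ suc) + sumFin (λ j → x₀ - + x (suc j))
      ∎
    where open ≡-Reasoning
          x₀ : ℤ
          x₀ = + x zero
          split : ∀ c y x₀ → (c - + 1) * y ≡ c * y + (x₀ - y) + - x₀
          split = solve-∀
          cancel : ∀ k x h d → k * x + (h + d + k * - x) ≡ h + d
          cancel = solve-∀

  ∼⇒diff-≡ : ∀ {k} {x y : Point k} → x ∼ y → ∀ i j → + x i - + x j ≡ + y i - + y j
  ∼⇒diff-≡ {x = x} {y} x∼y i j = begin
    + x i - + x j                    ≡⟨ lemma (+ x i) (+ x j) (+ y j) ⟩
    + x i + + y j - (+ x j + + y j)  ≡⟨ cong (λ s → s - (+ x j + + y j)) cross-ℤ ⟩
    + y i + + x j - (+ x j + + y j)  ≡⟨ lemma′ (+ y i) (+ x j) (+ y j) ⟩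
    + y i - + y j                    ∎
    where open ≡-Reasoning
          cross-ℤ : + x i + + y j ≡ + y i + + x j
          cross-ℤ = trans (ℤ.pos-+ (x i) (y j)) (trans (cong +_ (cross x∼y i j)) (sym (ℤ.pos-+ (y i) (x j))))
          lemma : ∀ a b d → a - b ≡ a + d - (b + d)
          lemma = solve-∀
          lemma′ : ∀ c b d → c + b - (b + d) ≡ c - d
          lemma′ = solve-∀

  ssHeightℤ-∼ : ∀ {k} {x y : Point k} → x ∼ y → ssHeightℤ x ≡ ssHeightℤ y
  ssHeightℤ-∼ {zero}          x∼y = refl
  ssHeightℤ-∼ {suc k} {x} {y} x∼y = begin
    ssHeightℤ x
      ≡⟨ ssHeightℤ-tail x ⟩
    ssHeightℤ (x ∘ suc) + sumFin (λ j → + x zero - + x (suc j))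
      ≡⟨ cong₂ _+_ (ssHeightℤ-∼ (shifted λ i j → cross x∼y (suc i) (suc j)))
                   (sumOver-cong (allFin k) λ j → ∼⇒diff-≡ x∼y zero (suc j)) ⟩
    ssHeightℤ (y ∘ suc) + sumFin (λ j → + y zero - + y (suc j))
      ≡⟨ ssHeightℤ-tail y ⟨
    ssHeightℤ y
      ∎
    where open ≡-Reasoning

  ssHeightℤ-nonneg : ∀ {k} {x : Point k} → Ballot x → + 0 ≤ ssHeightℤ x
  ssHeightℤ-nonneg {zero}          ballot = ℤ.≤-refl
  ssHeightℤ-nonneg {suc k} {x} ballot = subst (+ 0 ≤_) (sym (ssHeightℤ-tail x))
    (ℤ.+-mono-≤ (ssHeightℤ-nonneg (Ballot-tail ballot)) (sumOver-nonneg (Ballot-gap ballot ∘ suc) (allFin k)))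

  ssHeightℤ-spread : ∀ {k} {x : Point (suc k)} → Ballot x → ∀ j → + x zero - + x j ≤ ssHeightℤ x
  ssHeightℤ-spread {x = x} ballot zero =
    subst (_≤ ssHeightℤ x) (sym (ℤ.+-inverseʳ (+ x zero))) (ssHeightℤ-nonneg ballot)
  ssHeightℤ-spread {k} {x} ballot (suc j) = begin
    + x zero - + x (suc j)                                        ≤⟨ ≤-sumOver (Ballot-gap ballot ∘ suc) (∈-allFin j) ⟩
    sumFin (λ j → + x zero - + x (suc j))                         ≤⟨ i≤j+i (ssHeightℤ-nonneg (Ballot-tail ballot)) ⟩
    ssHeightℤ (x ∘ suc) + sumFin (λ j → + x zero - + x (suc j))   ≡⟨ ssHeightℤ-tail x ⟨
    ssHeightℤ x                                                   ∎
    where open ℤ.≤-Reasoning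

  boxPoint : ∀ {k T} → Fin (suc T ^ k) → Point k
  boxPoint c j = toℕ (finToFun c j)

  diff<⇒< : ∀ {a b c} → + a - + b < + c → a ℕ.< b ℕ.+ c
  diff<⇒< {a} {b} {c} a-b<c = ℤ.drop‿+<+ (subst₂ _<_ (lemma (+ a) (+ b))
    (trans (ℤ.+-comm (+ c) (+ b)) (sym (ℤ.pos-+ b c))) (ℤ.+-monoˡ-< (+ b) a-b<c))
    where lemma : ∀ a b → a - b + b ≡ a
          lemma = solve-∀

  -- Translating x so that its first coordinate becomes T lands in the box [0, T]^(k+1).
  in-box : ∀ {k T} {x : Point (suc k)} → Ballot x → ssHeightℤ x < + T →
    Σ (Fin (suc T ^ suc k)) λ c → x ∼ boxPoint c
  in-box {k} {T} {x} ballot x<T = funToFin cell , shifted x∼box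
    where
    x₀ : ℕ
    x₀ = x zero

    y : Point (suc k)
    y j = x j ℕ.+ T ℕ.∸ x₀

    y+x₀ : ∀ j → y j ℕ.+ x₀ ≡ x j ℕ.+ T
    y+x₀ j = ℕ.m∸n+n≡m (ℕ.<⇒≤ (diff<⇒< (ℤ.≤-<-trans (ssHeightℤ-spread ballot j) x<T)))

    y≤T : ∀ j → y j ℕ.≤ T
    y≤T j = subst (y j ℕ.≤_) (ℕ.m+n∸m≡n x₀ T) (ℕ.∸-monoˡ-≤ x₀ (ℕ.+-monoˡ-≤ T (ballot z≤n)))

    x∼y : ∀ i j → x i ℕ.+ y j ≡ y i ℕ.+ x j
    x∼y i j = ℕ.+-cancelʳ-≡ x₀ (x i ℕ.+ y j) (y i ℕ.+ x j) (begin
      x i ℕ.+ y j ℕ.+ x₀     ≡⟨ ℕ.+-assoc (x i) (y j) x₀ ⟩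
      x i ℕ.+ (y j ℕ.+ x₀)   ≡⟨ cong (x i ℕ.+_) (y+x₀ j) ⟩
      x i ℕ.+ (x j ℕ.+ T)    ≡⟨ lemma (x i) (x j) T ⟩
      x i ℕ.+ T ℕ.+ x j      ≡⟨ cong (ℕ._+ x j) (y+x₀ i) ⟨
      y i ℕ.+ x₀ ℕ.+ x j     ≡⟨ lemma′ (y i) x₀ (x j) ⟩
      y i ℕ.+ x j ℕ.+ x₀     ∎)
      where open ≡-Reasoning
            lemma : ∀ a b t → a ℕ.+ (b ℕ.+ t) ≡ a ℕ.+ t ℕ.+ b
            lemma = ℕ-Solver.solve-∀
            lemma′ : ∀ a z b → a ℕ.+ z ℕ.+ b ≡ a ℕ.+ b ℕ.+ z
            lemma′ = ℕ-Solver.solve-∀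

    cell : Fin (suc k) → Fin (suc T)
    cell j = fromℕ< (s≤s (y≤T j))

    boxed : ∀ j → boxPoint (funToFin cell) j ≡ y j
    boxed j = trans (cong toℕ (finToFun-funToFin cell j)) (toℕ-fromℕ< (s≤s (y≤T j)))

    x∼box : ∀ i j → x i ℕ.+ boxPoint (funToFin cell) j ≡ boxPoint (funToFin cell) i ℕ.+ x j
    x∼box i j = subst₂ (λ a b → x i ℕ.+ b ≡ a ℕ.+ x j) (sym (boxed i)) (sym (boxed j)) (x∼y i j)

  size : ∀ {k} → Point k → ℤ
  size = linear (λ _ → + 1)

  isDiagonalAt-size : ∀ {k} n (y : Point (suc k)) → size y ≡ + (suc k ℕ.* n) → isDiagonalAt n y ≡ isDiagonal y
  isDiagonalAt-size {k} n y size≡ = ⇔→≡ (mk⇔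
    (λ h → subst (λ v → isDiagonalAt v y ≡ true) (sym (first-at-level h)) h)
    (λ h → subst (λ v → isDiagonalAt v y ≡ true) (first-from-size h) h))
    where
    first-at-level : isDiagonalAt n y ≡ true → y zero ≡ n
    first-at-level h = ℕ.≡ᵇ⇒≡ (y zero) n (subst T (sym (allB-sound (λ i → y i ℕ.≡ᵇ n) h (∈-allFin zero))) _)

    first-from-size : isDiagonal y ≡ true → y zero ≡ n
    first-from-size h = ℕ.*-cancelˡ-≡ (y zero) n (suc k) (ℤ.+-injective (begin
      + (suc k ℕ.* y zero)                   ≡⟨ ℤ.pos-* (suc k) (y zero) ⟩
      + suc k * + y zero                     ≡⟨ cong (+ suc k *_) (ℤ.*-identityˡ (+ y zero)) ⟨
      + suc k * (+ 1 * + y zero)             ≡⟨ sumFin-const (suc k) (+ 1 * + y zero) ⟨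
      sumFin {suc k} (λ _ → + 1 * + y zero)  ≡⟨ sumOver-cong (allFin (suc k)) (cong (λ v → + 1 * + v) ∘ diagonal) ⟨
      size y                                 ≡⟨ size≡ ⟩
      + (suc k ℕ.* n)                        ∎))
      where open ≡-Reasoning
            diagonal : ∀ j → y j ≡ y zero
            diagonal j = ℕ.≡ᵇ⇒≡ (y j) (y zero) (subst T (sym (allB-sound (λ i → y i ℕ.≡ᵇ y zero) h (∈-allFin j))) _)

  module Paths {k₁ : ℕ} (b c : ℕ → ℤ) where

    k : ℕ
    k = suc k₁

    weight : Point k → Fin k → ℤ
    weight x i = if isUp i then b (ssHeight x) else c (ssHeight (step x i))

    pathSum : (allowed final : Point k → Bool) → ℕ → Point k → ℤ
    pathSum allowed final zero    x = if allowed x ∧ final x then + 1 else + 0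
    pathSum allowed final (suc L) x =
      if allowed x then sumFin (λ i → weight x i * pathSum allowed final L (step x i)) else + 0

    ballotWeight : ℕ → Point k → List (Fin k) → ℤ
    ballotWeight n x w = if ballotFrom n x w then sswtFrom b c x w else + 0

    ballotWeight-∷ : ∀ n x i w →
      ballotWeight n x (i ∷ w) ≡ (if isBallotPoint x then weight x i * ballotWeight n (step x i) w else + 0)
    ballotWeight-∷ n x i w with isBallotPoint x | ballotFrom n (step x i) w
    ... | false | _     = refl
    ... | true  | true  = refl
    ... | true  | false = sym (ℤ.*-zeroʳ (weight x i))

    sum-ballotWeight : ∀ n L x →
      sumOver (words k L) (ballotWeight n x) ≡ pathSum isBallotPoint (isDiagonalAt n) L x
    sum-ballotWeight n zero    x = ℤ.+-identityʳ _
    sum-ballotWeight n (suc L) x = begin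
      sumOver (words k (suc L)) (ballotWeight n x)
        ≡⟨ sumOver-words-suc k L (ballotWeight n x) ⟩
      sumFin (λ i → sumOver (words k L) (λ w → ballotWeight n x (i ∷ w)))
        ≡⟨ sumOver-cong (allFin k) (λ i → trans (sumOver-cong (words k L) (ballotWeight-∷ n x i))
                                                (sumOver-if-* ballot (words k L) (weight x i) _)) ⟩
      sumFin (λ i → if ballot then weight x i * sumOver (words k L) (ballotWeight n (step x i)) else + 0)
        ≡⟨ sumOver-if ballot (allFin k) _ ⟩
      (if ballot then sumFin (λ i → weight x i * sumOver (words k L) (ballotWeight n (step x i))) else + 0)
        ≡⟨ cong (λ s → if ballot then s else + 0) (sumOver-cong (allFin k) λ i →
             cong (weight x i *_) (sum-ballotWeight n L (step x i))) ⟩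
      pathSum isBallotPoint (isDiagonalAt n) (suc L) x
        ∎
      where open ≡-Reasoning
            ballot : Bool
            ballot = isBallotPoint x

    pathSum-final-cong : ∀ {allowed final final′} L x → (∀ y → size y ≡ size x + + L → final y ≡ final′ y) →
      pathSum allowed final L x ≡ pathSum allowed final′ L x
    pathSum-final-cong {allowed} zero x agree =
      cong (λ f → if allowed x ∧ f then + 1 else + 0) (agree x (sym (ℤ.+-identityʳ (size x))))
    pathSum-final-cong {allowed} (suc L) x agree =
      cong (λ s → if allowed x then s else + 0) (sumOver-cong (allFin k) λ i →
        cong (weight x i *_) (pathSum-final-cong L (step x i) λ y sizeʸ → agree y (trans sizeʸ (size-step i))))
      where
      size-step : ∀ i → size (step x i) + + L ≡ size x + + suc L
      size-step i = trans (cong (_+ + L) (linear-step (λ _ → + 1) x i)) (lemma (size x) (+ L))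
        where lemma : ∀ s l → + 1 + s + l ≡ s + (+ 1 + l)
              lemma = solve-∀

    -- A path of length k n from the origin ends on the diagonal exactly when it ends at (n, …, n).
    ssCatalan≡pathSum : ∀ n → ssCatalan k b c n ≡ pathSum isBallotPoint isDiagonal (k ℕ.* n) origin
    ssCatalan≡pathSum n = begin
      ssCatalan k b c n
        ≡⟨ sumOver-filterB _ (sswt b c) (words k (k ℕ.* n)) ⟩
      sumOver (words k (k ℕ.* n)) (ballotWeight n origin)
        ≡⟨ sum-ballotWeight n (k ℕ.* n) origin ⟩
      pathSum isBallotPoint (isDiagonalAt n) (k ℕ.* n) origin
        ≡⟨ pathSum-final-cong (k ℕ.* n) origin (λ y sizeʸ → isDiagonalAt-size n y
             (trans sizeʸ (cong (_+ + (k ℕ.* n)) (linear-origin {k} (λ _ → + 1))))) ⟩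
      pathSum isBallotPoint isDiagonal (k ℕ.* n) origin
        ∎
      where open ≡-Reasoning

    Invariant : (Point k → Bool) → Set
    Invariant p = ∀ {x y} → x ∼ y → p x ≡ p y

    weight-∼ : ∀ {x y} i → x ∼ y → weight x i ≡ weight y i
    weight-∼ i x∼y = cong₂ (λ h h′ → if isUp i then b h else c h′)
      (cong ℤ.∣_∣ (ssHeightℤ-∼ x∼y)) (cong ℤ.∣_∣ (ssHeightℤ-∼ (step-∼ i x∼y)))

    pathSum-∼ : ∀ {allowed final} → Invariant allowed → Invariant final →
      ∀ L {x y} → x ∼ y → pathSum allowed final L x ≡ pathSum allowed final L y
    pathSum-∼ allowed-∼ final-∼ zero    x∼y =
      cong₂ (λ p q → if p ∧ q then + 1 else + 0) (allowed-∼ x∼y) (final-∼ x∼y)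
    pathSum-∼ allowed-∼ final-∼ (suc L) x∼y =
      cong₂ (λ p s → if p then s else + 0) (allowed-∼ x∼y) (sumOver-cong (allFin k) λ i →
        cong₂ _*_ (weight-∼ i x∼y) (pathSum-∼ allowed-∼ final-∼ L (step-∼ i x∼y)))

    pathSum-disallowed : ∀ {allowed final} L {x} → allowed x ≡ false → pathSum allowed final L x ≡ + 0
    pathSum-disallowed zero    notAllowed rewrite notAllowed = refl
    pathSum-disallowed (suc L) notAllowed rewrite notAllowed = refl

    pathSum-suc-cong-mod : ∀ {allowed final m L L′} →
      (∀ x → pathSum allowed final L x ≡ pathSum allowed final L′ x mod m) →
      ∀ x → pathSum allowed final (suc L) x ≡ pathSum allowed final (suc L′) x mod m
    pathSum-suc-cong-mod {allowed} hyp x with allowed x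
    ... | false = ≡-mod-reflexive refl
    ... | true  = sumOver-cong-mod (allFin k) λ i → *-congˡ-mod (weight x i) (hyp (step x i))

    below : ℕ → Point k → Bool
    below T x = does (ssHeightℤ x ℤ.<? + T)

    below-true : ∀ {x T} → ssHeightℤ x < + T → below T x ≡ true
    below-true {x} {T} = dec-true (ssHeightℤ x ℤ.<? + T)

    lowBallot : ℕ → Point k → Bool
    lowBallot T x = below T x ∧ isBallotPoint x

    lowBallot-∼ : ∀ T → Invariant (lowBallot T)
    lowBallot-∼ T x∼y = cong₂ _∧_ (cong (λ h → does (h ℤ.<? + T)) (ssHeightℤ-∼ x∼y)) (isBallotPoint-∼ x∼y)

    lowBallot-sound : ∀ {T x} → lowBallot T x ≡ true → ssHeightℤ x < + T × Ballot x
    lowBallot-sound {T} {x} allowed with ssHeightℤ x ℤ.<? + T | isBallotPoint x in ballot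
    ... | yes x<T | true = x<T , isBallotPoint⇒Ballot {x = x} ballot

    full : ℕ → Point k → ℤ
    full = pathSum isBallotPoint isDiagonal

    truncated : ℕ → ℕ → Point k → ℤ
    truncated T = pathSum (lowBallot T) isDiagonal

    up-crossing : ∀ {x i T} → isBallotPoint x ≡ true → ssHeightℤ x < + T → + T ≤ ssHeightℤ (step x i) →
      ssHeight x ℕ.< T × T ℕ.≤ ssHeight x ℕ.+ k₁
    up-crossing {x} {i} {T} ballot x<T T≤x′ =
      ℤ.drop‿+<+ (subst (_< + T) (sym height≡) x<T) ,
      subst (T ℕ.≤_) (ℕ.+-comm k₁ (ssHeight x)) (ℤ.drop‿+≤+ (ℤ.≤-trans T≤x′
        (subst (ssHeightℤ (step x i) ≤_) (cong (λ h → + k₁ + h) (sym height≡)) (ssHeightℤ-step-≤ {k₁} x i))))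
      where height≡ : + ssHeight x ≡ ssHeightℤ x
            height≡ = ℤ.0≤i⇒+∣i∣≡i (ssHeightℤ-nonneg (isBallotPoint⇒Ballot {x = x} ballot))

    step-below : ∀ {x T} i → ssHeightℤ x < + T → ssHeightℤ (step x i) < + (T ℕ.+ k₁)
    step-below {x} {T} i x<T = ℤ.≤-<-trans (ssHeightℤ-step-≤ {k₁} x i)
      (subst (+ k₁ + ssHeightℤ x <_) (trans (sym (ℤ.pos-+ k₁ T)) (cong +_ (ℕ.+-comm k₁ T))) (ℤ.+-monoʳ-< (+ k₁) x<T))

    module Truncation (m : ℤ) (T₂ : ℕ) where

      Agree : ℤ → ℕ → Point k → Set
      Agree r L x = r * full L x ≡ r * truncated T₂ L x mod m

      -- Only an up-step can cross level T: the other steps never raise the height.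
      agree-below : ∀ r {T} → T ℕ.≤ T₂ →
        (∀ {x i} → isBallotPoint x ≡ true → isUp i ≡ true → ssHeightℤ x < + T → + T ≤ ssHeightℤ (step x i) →
          ∀ L → Agree (r * b (ssHeight x)) L (step x i)) →
        ∀ L {x} → ssHeightℤ x < + T → Agree r L x
      agree-below r T≤T₂ crossing zero {x} x<T
        rewrite below-true {x} (ℤ.<-≤-trans x<T (+≤+ T≤T₂)) = ≡-mod-reflexive refl
      agree-below r {T} T≤T₂ crossing (suc L) {x} x<T
        rewrite below-true {x} (ℤ.<-≤-trans x<T (+≤+ T≤T₂)) with isBallotPoint x in ballot
      ... | false = ≡-mod-reflexive refl
      ... | true  = begin
        r * sumFin (λ i → weight x i * full L (step x i))            ≡⟨ *-distribˡ-sumOver r (allFin k) _ ⟩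
        sumFin (λ i → r * (weight x i * full L (step x i)))          ≈⟨ sumOver-cong-mod (allFin k) term ⟩
        sumFin (λ i → r * (weight x i * truncated T₂ L (step x i)))  ≡⟨ *-distribˡ-sumOver r (allFin k) _ ⟨
        r * sumFin (λ i → weight x i * truncated T₂ L (step x i))    ∎
        where
        open SetoidReasoning (≡-mod-setoid m)
        swap : ∀ r w a → r * (w * a) ≡ w * (r * a)
        swap = solve-∀
        term : ∀ i → r * (weight x i * full L (step x i)) ≡ r * (weight x i * truncated T₂ L (step x i)) mod m
        term i with ssHeightℤ (step x i) ℤ.<? + T
        ... | yes x′<T = begin
          r * (weight x i * full L (step x i))
            ≡⟨ swap r (weight x i) _ ⟩
          weight x i * (r * full L (step x i))
            ≈⟨ *-congˡ-mod (weight x i) (agree-below r T≤T₂ crossing L x′<T) ⟩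
          weight x i * (r * truncated T₂ L (step x i))
            ≡⟨ swap r (weight x i) _ ⟨
          r * (weight x i * truncated T₂ L (step x i))
            ∎
        ... | no x′≮T with isUp i in up
        ...   | false = ⊥-elim (x′≮T (ℤ.≤-<-trans (ssHeightℤ-step-nonUp x i up) x<T))
        ...   | true  = begin
          r * (b (ssHeight x) * full L (step x i))          ≡⟨ ℤ.*-assoc r _ _ ⟨
          r * b (ssHeight x) * full L (step x i)            ≈⟨ crossing ballot up x<T (ℤ.≮⇒≥ x′≮T) L ⟩
          r * b (ssHeight x) * truncated T₂ L (step x i)    ≡⟨ ℤ.*-assoc r _ _ ⟩
          r * (b (ssHeight x) * truncated T₂ L (step x i))  ∎

    module Windows {m : ℤ} (u : ℕ)
      (annihilate : ∀ {s s′} → u ℕ.≤ s → s ℕ.< u ℕ.+ k₁ → u ℕ.+ k₁ ℕ.≤ s′ → s′ ℕ.< u ℕ.+ k₁ ℕ.+ k₁ →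
                    m ∣ b s * b s′)
      where

      T₁ T₂ : ℕ
      T₁ = u ℕ.+ k₁
      T₂ = T₁ ℕ.+ k₁

      open Truncation m T₂

      agree-high : ∀ r → (∀ {s′} → T₁ ℕ.≤ s′ → s′ ℕ.< T₂ → m ∣ r * b s′) →
        ∀ L {x} → ssHeightℤ x < + T₂ → Agree r L x
      agree-high r annihilates = agree-below r ℕ.≤-refl crossing
        where
        crossing : ∀ {x i} → isBallotPoint x ≡ true → isUp i ≡ true → ssHeightℤ x < + T₂ →
          + T₂ ≤ ssHeightℤ (step x i) → ∀ L → Agree (r * b (ssHeight x)) L (step x i)
        crossing {x} {i} ballot _ x<T₂ T₂≤x′ L with up-crossing {x} {i} ballot x<T₂ T₂≤x′
        ... | s<T₂ , T₂≤s+k₁ = ∣⇒*-≡-mod _ _ (annihilates (ℕ.+-cancelʳ-≤ k₁ T₁ (ssHeight x) T₂≤s+k₁) s<T₂)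

      agree-low : ∀ L {x} → ssHeightℤ x < + T₁ → Agree (+ 1) L x
      agree-low = agree-below (+ 1) (ℕ.m≤m+n T₁ k₁) crossing
        where
        crossing : ∀ {x i} → isBallotPoint x ≡ true → isUp i ≡ true → ssHeightℤ x < + T₁ →
          + T₁ ≤ ssHeightℤ (step x i) → ∀ L → Agree (+ 1 * b (ssHeight x)) L (step x i)
        crossing {x} {i} ballot _ x<T₁ T₁≤x′ L with up-crossing {x} {i} ballot x<T₁ T₁≤x′
        ... | s<T₁ , T₁≤s+k₁ = agree-high (+ 1 * b s) annihilates L (step-below i x<T₁)
          where
          s : ℕ
          s = ssHeight x
          annihilates : ∀ {s′} → T₁ ℕ.≤ s′ → s′ ℕ.< T₂ → m ∣ + 1 * b s * b s′
          annihilates {s′} T₁≤s′ s′<T₂ = subst (m ∣_) (cong (_* b s′) (sym (ℤ.*-identityˡ (b s))))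
            (annihilate (ℕ.+-cancelʳ-≤ k₁ u s T₁≤s+k₁) s<T₁ T₁≤s′ s′<T₂)

      full≡truncated : ∀ L {x} → ssHeightℤ x < + T₁ → full L x ≡ truncated T₂ L x mod m
      full≡truncated L x<T₁ =
        subst₂ (λ p q → p ≡ q mod m) (ℤ.*-identityˡ _) (ℤ.*-identityˡ _) (agree-low L x<T₁)

    module _ (M : ℕ) .{{_ : NonZero M}} (T : ℕ) where

      Congruent : ℕ → ℕ → Set
      Congruent L L′ = ∀ x → truncated T L x ≡ truncated T L′ x mod + M

      code : ℕ → Fin (M ^ (suc T ^ k))
      code L = funToFin λ c → residue M (truncated T L (boxPoint c))

      code-determines : ∀ {L L′} → code L ≡ code L′ → Congruent L L′
      code-determines {L} {L′} same x with lowBallot T x in allowed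
      ... | false = ≡-mod-reflexive (trans (pathSum-disallowed L allowed) (sym (pathSum-disallowed L′ allowed)))
      ... | true with lowBallot-sound {T} {x} allowed
      ...   | x<T , ballot with in-box ballot x<T
      ...     | c , x∼c = begin
        truncated T L x              ≡⟨ pathSum-∼ (lowBallot-∼ T) isDiagonal-∼ L x∼c ⟩
        truncated T L (boxPoint c)   ≈⟨ residue-≡⇒≡-mod M same-residue ⟩
        truncated T L′ (boxPoint c)  ≡⟨ pathSum-∼ (lowBallot-∼ T) isDiagonal-∼ L′ x∼c ⟨
        truncated T L′ x             ∎
        where
        open SetoidReasoning (≡-mod-setoid (+ M))
        same-residue : residue M (truncated T L (boxPoint c)) ≡ residue M (truncated T L′ (boxPoint c))
        same-residue =
          trans (sym (finToFun-funToFin _ c)) (trans (cong (λ f → finToFun f c) same) (finToFun-funToFin _ c))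

      truncated-eventually-periodic :
        Σ ℕ λ N → Σ ℕ λ p → 1 ℕ.≤ p × (∀ c {L} → N ℕ.≤ L → Congruent L (L ℕ.+ c ℕ.* p))
      truncated-eventually-periodic = eventually-periodic Congruent
        (λ x → ≡-mod-reflexive refl) (λ r r′ x → ≡-mod-trans (r x) (r′ x))
        (λ {L} {L′} → pathSum-suc-cong-mod {lowBallot T} {isDiagonal} {+ M} {L} {L′})
        code (λ {L} {L′} → code-determines {L} {L′})

    ssCatalan-eventually-periodic : ∀ M .{{_ : NonZero M}} u → 1 ℕ.≤ u →
      (∀ {s s′} → u ℕ.≤ s → s ℕ.< u ℕ.+ k₁ → u ℕ.+ k₁ ℕ.≤ s′ → s′ ℕ.< u ℕ.+ k₁ ℕ.+ k₁ → + M ∣ b s * b s′) →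
      Σ ℕ λ N → Σ ℕ λ p → 1 ℕ.≤ p × (∀ n → N ℕ.≤ n → ssCatalan k b c (n ℕ.+ p) ≡ ssCatalan k b c n mod + M)
    ssCatalan-eventually-periodic M u 1≤u annihilate with truncated-eventually-periodic M (u ℕ.+ k₁ ℕ.+ k₁)
    ... | N , p , 1≤p , periodic = N , p , 1≤p , λ n N≤n → begin
      ssCatalan k b c (n ℕ.+ p)                  ≡⟨ ssCatalan≡pathSum (n ℕ.+ p) ⟩
      full (k ℕ.* (n ℕ.+ p)) origin              ≈⟨ full≡truncated (k ℕ.* (n ℕ.+ p)) origin<T₁ ⟩
      truncated T₂ (k ℕ.* (n ℕ.+ p)) origin      ≡⟨ cong (λ L → truncated T₂ L origin) (ℕ.*-distribˡ-+ k n p) ⟩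
      truncated T₂ (k ℕ.* n ℕ.+ k ℕ.* p) origin  ≈⟨ periodic k (ℕ.≤-trans N≤n (ℕ.m≤n*m n k)) origin ⟨
      truncated T₂ (k ℕ.* n) origin              ≈⟨ full≡truncated (k ℕ.* n) origin<T₁ ⟨
      full (k ℕ.* n) origin                      ≡⟨ ssCatalan≡pathSum n ⟨
      ssCatalan k b c n                          ∎
      where
      open Windows u annihilate
      open SetoidReasoning (≡-mod-setoid (+ M))
      origin<T₁ : ssHeightℤ (origin {k}) < + T₁
      origin<T₁ = subst (_< + T₁) (sym (linear-origin (ssCoeff k))) (+<+ (ℕ.≤-trans 1≤u (ℕ.m≤m+n u k₁)))

open import Defs
open import Data.Integer using (ℤ; +_; _-_)
open import Data.Integer.Divisibility using (_∣_)
open import Data.Integer.Divisibility.Signed as Signed using (∣ᵤ⇒∣; ∣⇒∣ᵤ)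
open import Data.Nat using (ℕ; suc; s≤s; _≤_; _<_; _+_; _*_)
open import Data.Nat.Properties using (≤-trans; <-≤-trans; <-irrefl; m≤m+n)
import Data.Nat.Tactic.RingSolver as ℕ-Solver
open import Data.Product using (Σ; _×_; _,_)
open import Relation.Binary.PropositionalEquality using (_≡_; _≢_; subst)
open SemisymmetricCatalan using (module Paths; ∣-difference)

theorem3p4 : (k m : ℕ) → 2 ≤ k → 1 ≤ m → (b c : ℕ → ℤ)
    → Σ ℕ (λ u → 1 ≤ u × ((j j′ : ℕ) → u ≤ j → j < u + 2 * k → u ≤ j′ → j′ < u + 2 * k
        → j ≢ j′ → (+ m) ∣ (b j Data.Integer.* b j′)))
    → Σ ℕ (λ N → Σ ℕ (λ p → 1 ≤ p × ((n : ℕ) → N ≤ n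
        → (+ m) ∣ (ssCatalan k b c (n + p) - ssCatalan k b c n))))
theorem3p4 0 _ () _ _ _ _
theorem3p4 1 _ (s≤s ()) _ _ _ _
theorem3p4 (suc (suc _)) 0 _ () _ _ _
theorem3p4 (suc (suc k₂)) (suc m′) _ _ b c (u , 1≤u , hyp) =
  let N , p , 1≤p , periodic = Paths.ssCatalan-eventually-periodic b c (suc m′) u 1≤u annihilate
  in  N , p , 1≤p , λ n N≤n → ∣⇒∣ᵤ (∣-difference (periodic n N≤n))
  where
  k₁ : ℕ
  k₁ = suc k₂

  T₂≤u+2k : u + k₁ + k₁ ≤ u + 2 * suc k₁
  T₂≤u+2k = subst (u + k₁ + k₁ ≤_) (lemma u k₁) (m≤m+n (u + k₁ + k₁) 2)
    where lemma : ∀ u k → u + k + k + 2 ≡ u + 2 * suc k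
          lemma = ℕ-Solver.solve-∀

  annihilate : ∀ {s s′} → u ≤ s → s < u + k₁ → u + k₁ ≤ s′ → s′ < u + k₁ + k₁ →
    + suc m′ Signed.∣ b s Data.Integer.* b s′
  annihilate {s} {s′} u≤s s<T₁ T₁≤s′ s′<T₂ = ∣ᵤ⇒∣ (hyp s s′ u≤s (<-≤-trans s<T₁ (≤-trans (m≤m+n _ k₁) T₂≤u+2k))
    (≤-trans (m≤m+n u k₁) T₁≤s′) (<-≤-trans s′<T₂ T₂≤u+2k) λ s≡s′ → <-irrefl s≡s′ (<-≤-trans s<T₁ T₁≤s′))
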